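{- (1) For every positive integer $m$ there exist $m$ pairwise non-isomorphic graphs that all have the same power domination polynomial. (2) There exist a connected graph and a disconnected graph having the same power domination polynomial. (3) There exist graphs on the same number $n$ of vertices with vertex connectivity $1$, $2$, and $n-1$ respectively, all having the same power domination polynomial.
   Context: Graphs are finite and simple. For $S\subseteq V(G)$, $S$ is a power dominating set if, after coloring $S$, coloring every neighbor of a vertex of $S$, and then repeatedly applying the forcing rule (a colored vertex with exactly one uncolored neighbor colors that neighbor) until no changes occur, all vertices are colored. The power domination polynomial is $\mathcal{P}(G;x)=\sum_{i=1}^{|V(G)|}p(G;i)x^i$, where $p(G;i)$ is the number of power dominating sets of size $i$. -}

module Defs where

open import Data.Nat using (ℕ; zero; suc; _≡ᵇ_)
open import Data.Bool using (Bool; true; false; _∧_; _∨_; not; if_then_else_)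
open import Data.Fin using (Fin; _≟_)
open import Data.Fin.Subset using (Subset; ∣_∣; _∉_)
open import Data.Vec using (Vec; []; _∷_; lookup; tabulate)
open import Data.List using (List; []; _∷_; _++_; map; allFin)
open import Data.Bool.ListAction using (any; all)
open import Data.Product using (Σ; ∃; _×_; _,_)
open import Relation.Nullary using (¬_)
open import Relation.Nullary.Decidable using (⌊_⌋)
open import Relation.Binary.PropositionalEquality using (_≡_)
open import Function.Bundles using (_↔_; Inverse)

record Graph : Set where
  field
    n      : ℕ
    adj    : Fin n → Fin n → Bool
    sym    : ∀ u v → adj u v ≡ adj v u
    irrefl : ∀ v → adj v v ≡ false
open Graph public

Iso : Graph → Graph → Set
Iso G H = Σ (Fin (n G) ↔ Fin (n H)) λ f →
  ∀ u v → adj G u v ≡ adj H (Inverse.to f u) (Inverse.to f v)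

Coloring : ℕ → Set
Coloring k = Fin k → Bool

domStep : (G : Graph) → Subset (n G) → Coloring (n G)
domStep G S v = lookup S v ∨ any (λ u → lookup S u ∧ adj G u v) (allFin (n G))

forces : (G : Graph) → Coloring (n G) → Fin (n G) → Fin (n G) → Bool
forces G c u v =
  c u ∧ adj G u v ∧ not (c v) ∧
  all (λ w → not (adj G u w ∧ not (c w)) ∨ ⌊ w ≟ v ⌋) (allFin (n G))

forceStep : (G : Graph) → Coloring (n G) → Coloring (n G)
forceStep G c v = c v ∨ any (λ u → forces G c u v) (allFin (n G))

iter : ∀ {A : Set} → ℕ → (A → A) → A → A
iter zero    f a = a
iter (suc k) f a = f (iter k f a)

-- final colored set: n rounds of forcing suffice to reach the fixed point,
-- since every round that changes anything colors at least one new vertex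
observed : (G : Graph) → Subset (n G) → Coloring (n G)
observed G S = iter (n G) (forceStep G) (domStep G S)

isPDS : (G : Graph) → Subset (n G) → Bool
isPDS G S = all (observed G S) (allFin (n G))

allSubsets : (k : ℕ) → List (Subset k)
allSubsets zero    = [] ∷ []
allSubsets (suc k) = map (true ∷_) (allSubsets k) ++ map (false ∷_) (allSubsets k)

countB : ∀ {A : Set} → (A → Bool) → List A → ℕ
countB p []       = 0
countB p (x ∷ xs) = if p x then suc (countB p xs) else countB p xs

pdCoeff : Graph → ℕ → ℕ
pdCoeff G i = countB (λ S → (∣ S ∣ ≡ᵇ i) ∧ isPDS G S) (allSubsets (n G))

-- P(G;x) = Σ_{i=1}^{|V|} p(G;i) x^i ; two such polynomials are equal iff all
-- coefficients of x^i for i ≥ 1 agree (p(G;i) = 0 for i > |V(G)| automatically)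
SamePDP : Graph → Graph → Set
SamePDP G H = ∀ i → 1 Data.Nat.≤ i → pdCoeff G i ≡ pdCoeff H i

data ReachAvoid (G : Graph) (X : Subset (n G)) : Fin (n G) → Fin (n G) → Set where
  here : ∀ {v} → v ∉ X → ReachAvoid G X v v
  step : ∀ {u w v} → u ∉ X → adj G u w ≡ true →
         ReachAvoid G X w v → ReachAvoid G X u v

emptySet : (k : ℕ) → Subset k
emptySet k = tabulate (λ _ → false)

Connected : Graph → Set
Connected G = ∀ u v → ReachAvoid G (emptySet (n G)) u v

Disconnects : (G : Graph) → Subset (n G) → Set
Disconnects G X = Σ (Fin (n G)) λ u → Σ (Fin (n G)) λ v →
  u ∉ X × v ∉ X × ¬ ReachAvoid G X u v

Separating : (G : Graph) → Subset (n G) → Set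
Separating G X = Disconnects G X ⊎′ (∀ u v → u ∉ X → v ∉ X → u ≡ v)
  where open import Data.Sum using () renaming (_⊎_ to _⊎′_)

VertexConnectivity : Graph → ℕ → Set
VertexConnectivity G k =
  (Σ (Subset (n G)) λ X → ∣ X ∣ ≡ k × Separating G X) ×
  (∀ (X : Subset (n G)) → ∣ X ∣ Data.Nat.< k → ¬ Separating G X)

module Submission where

-- (1) Call a graph nearly complete when every vertex is adjacent to all other vertices but
--     at most one. On n ≥ 3 vertices a single vertex s of such a graph is power dominating:
--     domination from s colors everything except the non-neighbour v of s, and any third
--     vertex u is adjacent to s and v, so it forces v. Hence the power dominating sets are
--     exactly the nonempty sets and p(G;i) depends on n only. Deleting t = 0, …, m - 1
--     disjoint edges from K_{2m+1} gives m nearly complete graphs; they are pairwise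
--     non-isomorphic since an isomorphism would inject the removed edges of one graph into
--     the fewer removed edges of the other (pigeonhole principle).
-- (2), (3) concern explicit small graphs. Connectivity facts are certified by a breadth-first
--     search proved sound (it only finds genuine walks) together with closed vertex sets as
--     certificates of disconnection, checked for all candidate separators; the power domination
--     coefficients are evaluated directly.

open import Defs
open import Data.Nat using (ℕ; zero; suc; _+_; _∸_; _≡ᵇ_; _<ᵇ_; _≤_; _<_; s≤s; z≤n; z<s)
open import Data.Nat.Properties using (≡ᵇ⇒≡; ≡⇒≡ᵇ; <ᵇ⇒<; <⇒<ᵇ; <⇒≱; <-≤-trans; ≤-<-trans; <-trans; ≤-refl; m≤n+m; m≤m+n; m<m+n; +-suc; +-monoˡ-<; <-irrefl; +-cancelʳ-≡; <-cmp; <⇒≤)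
open import Data.Bool using (Bool; true; false; _∧_; _∨_; not; T)
import Data.Bool as Bool
open import Data.Bool.Properties using (T-≡; T-not-≡; T-∧; T-∨; ⇔→≡; ∨-comm)
open import Data.Fin using (Fin; zero; suc; toℕ; _≟_; fromℕ<)
open import Data.Fin.Subset using (Subset; ∣_∣; _∈_; _∉_)
open import Data.Fin.Properties using (toℕ-injective; toℕ<n; toℕ-fromℕ<; fromℕ<-injective; pigeonhole)
open import Data.Vec using (Vec; []; _∷_; lookup)
open import Data.Vec.Properties using ([]=⇒lookup; lookup⇒[]=; lookup∘tabulate)
open import Data.List using ([]; _∷_; map; allFin)
open import Data.List.Relation.Unary.Any using () renaming (here to hereᴸ)
open import Data.List.Membership.Propositional using () renaming (_∈_ to _∈ᴸ_)
open import Data.List.Membership.Propositional.Properties using (∈-map⁺; ∈-++⁺ˡ; ∈-++⁺ʳ)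
open import Data.Bool.ListAction using (any; all)
open import Data.List.Relation.Unary.Any.Properties as Any using (any⁺; any⁻)
open import Data.List.Relation.Unary.All using () renaming (lookup to All-lookup)
open import Data.List.Relation.Unary.All.Properties as All using (all⁺; all⁻)
open import Data.Empty using (⊥)
open import Relation.Binary.Definitions using (tri<; tri≈; tri>)
open import Data.Product using (Σ; ∃; _×_; _,_; proj₁; proj₂)
open import Data.Sum using (_⊎_; inj₁; inj₂; [_,_]′)
open import Function.Bundles using (mk⇔; Equivalence; Inverse; Injection)
open import Function.Definitions using (Injective)
open import Function.Properties.Inverse using (↔⇒↣; ↔-sym)
open Equivalence using (to; from)
open import Relation.Nullary using (¬_; yes; no; contradiction)
open import Relation.Nullary.Decidable using (⌊_⌋; T?; toWitness; fromWitness)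
open import Relation.Binary.PropositionalEquality using (_≡_; _≢_; refl; trans; cong; subst; module ≡-Reasoning)
  renaming (sym to ≡-sym)

anyFin⁺ : ∀ {k} (p : Fin k → Bool) x → T (p x) → T (any p (allFin k))
anyFin⁺ p x px = any⁺ p (Any.tabulate⁺ x px)

anyFin⁻ : ∀ {k} (p : Fin k → Bool) → T (any p (allFin k)) → ∃ λ x → T (p x)
anyFin⁻ p h = Any.tabulate⁻ (any⁻ p _ h)

allFin⁺ : ∀ {k} (p : Fin k → Bool) → (∀ x → T (p x)) → T (all p (allFin k))
allFin⁺ p h = all⁻ p (All.tabulate⁺ h)

allFin⁻ : ∀ {k} (p : Fin k → Bool) → T (all p (allFin k)) → ∀ x → T (p x)
allFin⁻ p h = All.tabulate⁻ (all⁺ p _ h)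

T-extensional : ∀ {x y} → (T x → T y) → (T y → T x) → x ≡ y
T-extensional x⇒y y⇒x = ⇔→≡ (mk⇔ (λ e → to T-≡ (x⇒y (from T-≡ e))) (λ e → to T-≡ (y⇒x (from T-≡ e))))

T-not : ∀ {x} → ¬ T x → T (not x)
T-not {false} _  = _
T-not {true}  ¬t = contradiction _ ¬t

not-T : ∀ {x} → T (not x) → ¬ T x
not-T {false} _ ()

≡ᵇ-sym : ∀ a b → (a ≡ᵇ b) ≡ (b ≡ᵇ a)
≡ᵇ-sym a b = T-extensional (flipped a b) (flipped b a)
  where
  flipped : ∀ x y → T (x ≡ᵇ y) → T (y ≡ᵇ x)
  flipped x y h = ≡⇒≡ᵇ y x (≡-sym (≡ᵇ⇒≡ x y h))

countB-cong : ∀ {A : Set} {p q : A → Bool} → (∀ x → p x ≡ q x) → ∀ xs → countB p xs ≡ countB q xs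
countB-cong p≗q []       = refl
countB-cong p≗q (x ∷ xs) rewrite p≗q x | countB-cong p≗q xs = refl

iter-preserves : ∀ {A : Set} (P : A → Set) {f : A → A} {a} → P a → (∀ c → P c → P (f c)) → ∀ k → P (iter k f a)
iter-preserves P pa preserved zero    = pa
iter-preserves P pa preserved (suc k) = preserved _ (iter-preserves P pa preserved k)

-- A property established by the first step and preserved afterwards holds after any
-- positive number of steps; the Fin k argument only witnesses that k is positive.
iter-after-first : ∀ {A : Set} (P : A → Set) {f : A → A} {a} → P (f a) → (∀ c → P c → P (f c)) →
                   ∀ {k} → Fin k → P (iter k f a)
iter-after-first P pfa preserved {suc zero}    _ = pfa
iter-after-first P pfa preserved {suc (suc k)} _ = preserved _ (iter-after-first P pfa preserved {suc k} zero)

-- A graph is nearly complete if every vertex is adjacent to all other vertices but at most one;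
-- equivalently, its complement is a partial matching.
NearlyComplete : Graph → Set
NearlyComplete G = ∀ s v w → v ≢ s → w ≢ s → ¬ T (adj G s v) → ¬ T (adj G s w) → v ≡ w

thirdElement : ∀ {k} → 3 ≤ k → (s v : Fin k) → ∃ λ u → u ≢ s × u ≢ v
thirdElement (s≤s (s≤s (s≤s _))) s v with s ≟ zero | v ≟ zero
... | no s≢0     | no v≢0     = zero , (λ e → s≢0 (≡-sym e)) , (λ e → v≢0 (≡-sym e))
... | yes refl   | yes refl   = suc zero , (λ ()) , (λ ())
... | yes refl   | no v≢0 with v ≟ suc zero
...   | yes refl = suc (suc zero) , (λ ()) , (λ ())
...   | no v≢1   = suc zero , (λ ()) , (λ e → v≢1 (≡-sym e))
thirdElement (s≤s (s≤s (s≤s _))) s v | no s≢0 | yes refl with s ≟ suc zero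
...   | yes refl = suc (suc zero) , (λ ()) , (λ ())
...   | no s≢1   = suc zero , (λ e → s≢1 (≡-sym e)) , (λ ())

nonempty : ∀ {k} → Subset k → Bool
nonempty {k} S = any (lookup S) (allFin k)

nonemptySubsetsOfSize : ℕ → ℕ → ℕ
nonemptySubsetsOfSize k i = countB (λ S → (∣ S ∣ ≡ᵇ i) ∧ nonempty S) (allSubsets k)

observed-empty : (G : Graph) (S : Subset (n G)) → ¬ T (nonempty S) → ∀ v → ¬ T (observed G S v)
observed-empty G S S-empty = iter-preserves Blank domBlank forceBlank (n G)
  where
  Blank : Coloring (n G) → Set
  Blank c = ∀ v → ¬ T (c v)
  inS : ∀ v → ¬ T (lookup S v)
  inS v sv = S-empty (anyFin⁺ (lookup S) v sv)
  domBlank : Blank (domStep G S)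
  domBlank v h with to T-∨ h
  ... | inj₁ sv = inS v sv
  ... | inj₂ nb with anyFin⁻ _ nb
  ...   | u , su∧adj = inS u (proj₁ (to T-∧ su∧adj))
  forceBlank : ∀ c → Blank c → Blank (forceStep G c)
  forceBlank c blank v h with to T-∨ h
  ... | inj₁ cv = blank v cv
  ... | inj₂ fv with anyFin⁻ _ fv
  ...   | u , fu = blank u (proj₁ (to T-∧ fu))

-- One entry of the uniqueness test in the forcing rule: the neighbour w is either the
-- forced vertex itself (d) or already colored (b).
uniqueEntry : ∀ a b d → T d ⊎ T b → T (not (a ∧ not b) ∨ d)
uniqueEntry false b     d     _        = _
uniqueEntry true  true  d     _        = _
uniqueEntry true  false true  _        = _
uniqueEntry true  false false (inj₁ ())
uniqueEntry true  false false (inj₂ ())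

-- In a nearly complete graph with at least three vertices a single vertex s already
-- observes everything: dominating from s colors all vertices but the non-neighbour v of s,
-- and any third vertex u is adjacent to both s and v, so v is the only uncolored
-- neighbour of the colored vertex u and gets forced.
module NearlyCompletePowerDomination (G : Graph) (nearly : NearlyComplete G) (three : 3 ≤ n G) where

  onlyUncolored : ∀ (c : Coloring (n G)) u v → (∀ w → w ≢ v → T (c w)) →
                  T (all (λ w → not (adj G u w ∧ not (c w)) ∨ ⌊ w ≟ v ⌋) (allFin (n G)))
  onlyUncolored c u v colored = allFin⁺ _ check
    where
    check : ∀ w → T (not (adj G u w ∧ not (c w)) ∨ ⌊ w ≟ v ⌋)
    check w with w ≟ v
    ... | yes _   = uniqueEntry (adj G u w) (c w) _ (inj₁ _)
    ... | no  w≢v = uniqueEntry (adj G u w) (c w) _ (inj₂ (colored w w≢v))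

  module _ (S : Subset (n G)) (s : Fin (n G)) (s∈S : T (lookup S s)) where

    dom : Coloring (n G)
    dom = domStep G S

    dom-s : T (dom s)
    dom-s = from T-∨ (inj₁ s∈S)

    dom-neighbour : ∀ w → T (adj G s w) → T (dom w)
    dom-neighbour w a = from T-∨ (inj₂ (anyFin⁺ _ s (from T-∧ (s∈S , a))))

    blank⇒≢s : ∀ {v} → ¬ T (dom v) → v ≢ s
    blank⇒≢s blank refl = blank dom-s

    blank⇒nonNeighbour : ∀ {v} → ¬ T (dom v) → ¬ T (adj G s v)
    blank⇒nonNeighbour blank a = blank (dom-neighbour _ a)

    dom-allBut : ∀ v → ¬ T (dom v) → ∀ w → w ≢ v → T (dom w)
    dom-allBut v blank w w≢v with w ≟ s | T? (adj G s w)
    ... | yes refl | _     = dom-s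
    ... | no  _    | yes a = dom-neighbour w a
    ... | no  w≢s  | no ¬a =
      contradiction (nearly s w v w≢s (blank⇒≢s blank) ¬a (blank⇒nonNeighbour blank)) w≢v

    force-all : ∀ v → T (forceStep G dom v)
    force-all v with T? (dom v)
    ... | yes dv    = from T-∨ (inj₁ dv)
    ... | no  blank = from T-∨ (inj₂ (anyFin⁺ _ u u-forces-v))
      where
      third = thirdElement three s v
      u = proj₁ third
      u≢s = proj₁ (proj₂ third)
      u≢v = proj₂ (proj₂ third)
      -- s is the non-neighbour of v, so v is adjacent to u ≠ s
      v~u : T (adj G v u)
      v~u with T? (adj G v u)
      ... | yes a = a
      ... | no ¬a = contradiction (nearly v s u (λ e → blank⇒≢s blank (≡-sym e)) u≢v ¬v~s ¬a) (λ e → u≢s (≡-sym e))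
        where
        ¬v~s : ¬ T (adj G v s)
        ¬v~s a = blank⇒nonNeighbour blank (subst T (sym G v s) a)
      u-forces-v : T (forces G dom u v)
      u-forces-v = from T-∧ (dom-allBut v blank u u≢v ,
                   from T-∧ (subst T (sym G v u) v~u ,
                   from T-∧ (T-not blank , onlyUncolored dom u v (dom-allBut v blank))))

  observed-all : (S : Subset (n G)) (s : Fin (n G)) → T (lookup S s) → ∀ v → T (observed G S v)
  observed-all S s s∈S = iter-after-first Full (force-all S s s∈S) stayFull s
    where
    Full : Coloring (n G) → Set
    Full c = ∀ v → T (c v)
    stayFull : ∀ c → Full c → Full (forceStep G c)
    stayFull c full v = from T-∨ (inj₁ (full v))

  isPDS≡nonempty : ∀ S → isPDS G S ≡ nonempty S
  isPDS≡nonempty S = T-extensional pds⇒nonempty nonempty⇒pds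
    where
    nonempty⇒pds : T (nonempty S) → T (isPDS G S)
    nonempty⇒pds h with anyFin⁻ _ h
    ... | s , s∈S = allFin⁺ _ (observed-all S s s∈S)
    pds⇒nonempty : T (isPDS G S) → T (nonempty S)
    pds⇒nonempty h with T? (nonempty S)
    ... | yes ne    = ne
    ... | no  empty = contradiction (allFin⁻ _ h vertex) (observed-empty G S empty vertex)
      where
      vertex : Fin (n G)
      vertex = fromℕ< three

  -- p(G;i) counts the nonempty i-subsets, so it depends on the order of G only
  pdCoeff-nearlyComplete : ∀ i → pdCoeff G i ≡ nonemptySubsetsOfSize (n G) i
  pdCoeff-nearlyComplete i =
    countB-cong (λ S → cong ((∣ S ∣ ≡ᵇ i) ∧_) (isPDS≡nonempty S)) (allSubsets (n G))

samePDP-nearlyComplete : ∀ G H → NearlyComplete G → NearlyComplete H → 3 ≤ n G → n G ≡ n H → SamePDP G H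
samePDP-nearlyComplete G H nearlyG nearlyH three order i _ = begin
  pdCoeff G i                        ≡⟨ NearlyCompletePowerDomination.pdCoeff-nearlyComplete G nearlyG three i ⟩
  nonemptySubsetsOfSize (n G) i      ≡⟨ cong (λ k → nonemptySubsetsOfSize k i) order ⟩
  nonemptySubsetsOfSize (n H) i      ≡⟨ ≡-sym (NearlyCompletePowerDomination.pdCoeff-nearlyComplete H nearlyH (subst (3 ≤_) order three) i) ⟩
  pdCoeff H i                        ∎
  where open ≡-Reasoning

InducedEmbedding : Graph → Graph → Set
InducedEmbedding G H = Σ (Fin (n G) → Fin (n H)) λ g →
  Injective _≡_ _≡_ g × (∀ a b → adj H (g a) (g b) ≡ adj G a b)

iso⇒embedding : ∀ {G H} → Iso G H → InducedEmbedding G H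
iso⇒embedding (f , preserves) = Inverse.to f , Injection.injective (↔⇒↣ f) , λ a b → ≡-sym (preserves a b)

iso-sym : ∀ {G H} → Iso G H → Iso H G
iso-sym {G} {H} (f , preserves) = ↔-sym f , reflects
  where
  open Inverse f using (strictlyInverseˡ)
  reflects : ∀ u v → adj H u v ≡ adj G (Inverse.from f u) (Inverse.from f v)
  reflects u v rewrite preserves (Inverse.from f u) (Inverse.from f v) | strictlyInverseˡ u | strictlyInverseˡ v = refl

-- The family for part (1): on N = 2M + 1 vertices labelled 0, …, 2M, the graph number t ≤ M
-- is the complete graph with the t disjoint edges {p, p + M}, p < t, removed.
module MatchingComplement (m : ℕ) where

  M : ℕ
  M = suc m

  -- N = 2M + 1 ≥ 3
  N : ℕ
  N = suc (suc (suc (m + m)))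

  -- {a, b} is the a-th removed edge
  removedB : ℕ → ℕ → ℕ → Bool
  removedB t a b = ((a + M) ≡ᵇ b) ∧ (a <ᵇ t)

  adjacentB : ℕ → ℕ → ℕ → Bool
  adjacentB t a b = not (a ≡ᵇ b) ∧ not (removedB t a b ∨ removedB t b a)

  adjacentB-sym : ∀ t a b → adjacentB t a b ≡ adjacentB t b a
  adjacentB-sym t a b rewrite ≡ᵇ-sym a b | ∨-comm (removedB t a b) (removedB t b a) = refl

  adjacentB-irrefl : ∀ t a → adjacentB t a a ≡ false
  adjacentB-irrefl t a rewrite to T-≡ (≡⇒≡ᵇ a a refl) = refl

  graph : ℕ → Graph
  graph t = record
    { n      = N
    ; adj    = λ u v → adjacentB t (toℕ u) (toℕ v)
    ; sym    = λ u v → adjacentB-sym t (toℕ u) (toℕ v)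
    ; irrefl = λ v → adjacentB-irrefl t (toℕ v)
    }

  RemovedEdge : ℕ → ℕ → ℕ → ℕ → Set
  RemovedEdge t p x y = p < t × ((x ≡ p × y ≡ p + M) ⊎ (x ≡ p + M × y ≡ p))

  extract : ∀ {t a b} → T (removedB t a b) → a + M ≡ b × a < t
  extract {t} {a} {b} h = ≡ᵇ⇒≡ (a + M) b (proj₁ (to T-∧ h)) , <ᵇ⇒< a t (proj₂ (to T-∧ h))

  removed⇒nonEdge : ∀ {t p} → p < t → ¬ T (adjacentB t p (p + M))
  removed⇒nonEdge {t} {p} p<t adjacent =
    not-T (proj₂ (to (T-∧ {not (p ≡ᵇ p + M)}) adjacent))
      (from (T-∨ {removedB t p (p + M)}) (inj₁ (from T-∧ (≡⇒≡ᵇ (p + M) _ refl , <⇒<ᵇ p<t))))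

  nonEdge⇒removed : ∀ {t x y} → x ≢ y → ¬ T (adjacentB t x y) → ∃ λ p → RemovedEdge t p x y
  nonEdge⇒removed {t} {x} {y} x≢y nonEdge with T? (removedB t x y) | T? (removedB t y x)
  ... | yes xy | _      = x , proj₂ (extract {t} xy) , inj₁ (refl , ≡-sym (proj₁ (extract {t} xy)))
  ... | no _   | yes yx = y , proj₂ (extract {t} yx) , inj₂ (≡-sym (proj₁ (extract {t} yx)) , refl)
  ... | no ¬xy | no ¬yx = contradiction adjacent nonEdge
    where
    adjacent : T (adjacentB t x y)
    adjacent = from T-∧ (T-not (λ e → x≢y (≡ᵇ⇒≡ x y e)) ,
                          T-not (λ e → [ ¬xy , ¬yx ]′ (to (T-∨ {removedB t x y}) e)))

  -- a low endpoint p < t ≤ M is never a high endpoint q + M ≥ M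
  low≢high : ∀ {t p q} → t ≤ M → p < t → p ≢ q + M
  low≢high t≤M p<t e = <⇒≱ (<-≤-trans p<t t≤M) (subst (M ≤_) (≡-sym e) (m≤n+m M _))

  partner-unique : ∀ {t p q a x y} → t ≤ M → RemovedEdge t p a x → RemovedEdge t q a y → x ≡ y
  partner-unique t≤M (_   , inj₁ (refl , refl)) (_   , inj₁ (refl , refl)) = refl
  partner-unique t≤M (p<t , inj₁ (refl , _))    (_   , inj₂ (a≡q+M , _))  = contradiction a≡q+M (low≢high t≤M p<t)
  partner-unique t≤M (_   , inj₂ (a≡p+M , _))  (q<t , inj₁ (refl , _))    = contradiction a≡p+M (low≢high t≤M q<t)
  partner-unique t≤M (_   , inj₂ (a≡p+M , refl)) (_ , inj₂ (a≡q+M , refl)) = +-cancelʳ-≡ M _ _ (trans (≡-sym a≡p+M) a≡q+M)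

  endpoints-unique : ∀ {t t′ p x y x′ y′} → RemovedEdge t p x y → RemovedEdge t′ p x′ y′ → x′ ≡ x ⊎ x′ ≡ y
  endpoints-unique (_ , inj₁ (refl , refl)) (_ , inj₁ (refl , refl)) = inj₁ refl
  endpoints-unique (_ , inj₁ (refl , refl)) (_ , inj₂ (refl , refl)) = inj₂ refl
  endpoints-unique (_ , inj₂ (refl , refl)) (_ , inj₁ (refl , refl)) = inj₂ refl
  endpoints-unique (_ , inj₂ (refl , refl)) (_ , inj₂ (refl , refl)) = inj₁ refl

  -- the non-neighbours of a vertex are its partners on removed edges, of which there is at most one
  nearlyComplete : ∀ t → t ≤ M → NearlyComplete (graph t)
  nearlyComplete t t≤M s v w v≢s w≢s ¬sv ¬sw =
    toℕ-injective (partner-unique t≤M (proj₂ (partner v v≢s ¬sv)) (proj₂ (partner w w≢s ¬sw)))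
    where
    partner : ∀ x → x ≢ s → ¬ T (adjacentB t (toℕ s) (toℕ x)) → ∃ λ p → RemovedEdge t p (toℕ s) (toℕ x)
    partner x x≢s = nonEdge⇒removed (λ e → x≢s (toℕ-injective (≡-sym e)))

  -- An embedding g
  -- maps the t₂ disjoint removed edges of graph t₂ to removed edges of graph t₁; two of
  -- them, k₁ < k₂, land on the same one, which forces k₂ ∈ {k₁, k₁ + M}.
  noEmbedding : ∀ {t₁ t₂} → t₁ < t₂ → t₂ ≤ M → ¬ InducedEmbedding (graph t₂) (graph t₁)
  noEmbedding {t₁} {t₂} t₁<t₂ t₂≤M (g , g-injective , g-adj) = contradict (endpoints-unique (proj₂ image₁) image₂)
    where
    k<M : (k : Fin t₂) → toℕ k < M
    k<M k = <-≤-trans (toℕ<n k) t₂≤M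
    M+M<N : M + M < N
    M+M<N rewrite +-suc m m = ≤-refl
    high< : (k : Fin t₂) → toℕ k + M < N
    high< k = <-trans (+-monoˡ-< M (k<M k)) M+M<N
    low high : Fin t₂ → Fin N
    low  k = fromℕ< (≤-<-trans (m≤m+n (toℕ k) M) (high< k))
    high k = fromℕ< (high< k)
    toℕ-low : ∀ k → toℕ (low k) ≡ toℕ k
    toℕ-low k = toℕ-fromℕ< _
    toℕ-high : ∀ k → toℕ (high k) ≡ toℕ k + M
    toℕ-high k = toℕ-fromℕ< _
    label : Fin N → ℕ
    label x = toℕ (g x)
    sameLabel : ∀ {x y} → label x ≡ label y → toℕ x ≡ toℕ y
    sameLabel e = cong toℕ (g-injective (toℕ-injective e))

    image : (k : Fin t₂) → ∃ λ p → RemovedEdge t₁ p (label (low k)) (label (high k))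
    image k = nonEdge⇒removed distinct nonEdge
      where
      distinct : label (low k) ≢ label (high k)
      distinct e = <-irrefl (trans (≡-sym (toℕ-low k)) (trans (sameLabel e) (toℕ-high k)))
                            (m<m+n (toℕ k) z<s)
      nonEdge : ¬ T (adjacentB t₁ (label (low k)) (label (high k)))
      nonEdge rewrite g-adj (low k) (high k) | toℕ-low k | toℕ-high k = removed⇒nonEdge (toℕ<n k)

    collision = pigeonhole t₁<t₂ (λ k → fromℕ< (proj₁ (proj₂ (image k))))
    k₁ k₂ : Fin t₂
    k₁ = proj₁ collision
    k₂ = proj₁ (proj₂ collision)
    image₁ = image k₁
    image₂ : RemovedEdge t₁ (proj₁ image₁) (label (low k₂)) (label (high k₂))
    image₂ = subst (λ p → RemovedEdge t₁ p (label (low k₂)) (label (high k₂)))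
                   (≡-sym (fromℕ<-injective _ _ _ _ (proj₂ (proj₂ (proj₂ collision)))))
                   (proj₂ (image k₂))
    contradict : label (low k₂) ≡ label (low k₁) ⊎ label (low k₂) ≡ label (high k₁) → ⊥
    contradict (inj₁ e) = <-irrefl (≡-sym (trans (≡-sym (toℕ-low k₂)) (trans (sameLabel e) (toℕ-low k₁))))
                                   (proj₁ (proj₂ (proj₂ collision)))
    contradict (inj₂ e) = low≢high t₂≤M (toℕ<n k₂) (trans (≡-sym (toℕ-low k₂)) (trans (sameLabel e) (toℕ-high k₁)))

  nonIsomorphic : ∀ {t₁ t₂} → t₁ ≢ t₂ → t₁ ≤ M → t₂ ≤ M → ¬ Iso (graph t₁) (graph t₂)
  nonIsomorphic {t₁} {t₂} t₁≢t₂ t₁≤M t₂≤M iso with <-cmp t₁ t₂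
  ... | tri< t₁<t₂ _ _ = noEmbedding t₁<t₂ t₂≤M (iso⇒embedding {graph t₂} {graph t₁} (iso-sym {graph t₁} {graph t₂} iso))
  ... | tri≈ _ t₁≡t₂ _ = t₁≢t₂ t₁≡t₂
  ... | tri> _ _ t₂<t₁ = noEmbedding t₂<t₁ t₁≤M (iso⇒embedding {graph t₁} {graph t₂} iso)

part1 : (m : ℕ) → 1 ≤ m →
  Σ (Fin m → Graph) λ Gs → (∀ i j → i ≢ j → ¬ Iso (Gs i) (Gs j)) × (∀ i j → SamePDP (Gs i) (Gs j))
part1 (suc m) _ = (λ i → graph (toℕ i)) , nonIso , samePDP
  where
  open MatchingComplement m
  index≤M : (i : Fin (suc m)) → toℕ i ≤ M
  index≤M i = <⇒≤ (toℕ<n i)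
  nonIso : ∀ i j → i ≢ j → ¬ Iso (graph (toℕ i)) (graph (toℕ j))
  nonIso i j i≢j = nonIsomorphic (λ e → i≢j (toℕ-injective e)) (index≤M i) (index≤M j)
  samePDP : ∀ i j → SamePDP (graph (toℕ i)) (graph (toℕ j))
  samePDP i j = samePDP-nearlyComplete (graph (toℕ i)) (graph (toℕ j))
    (nearlyComplete (toℕ i) (index≤M i)) (nearlyComplete (toℕ j) (index≤M j)) (s≤s (s≤s (s≤s z≤n))) refl

∈⇒T : ∀ {k} {X : Subset k} {u} → u ∈ X → T (lookup X u)
∈⇒T u∈X = from T-≡ ([]=⇒lookup u∈X)

T⇒∈ : ∀ {k} {X : Subset k} {u} → T (lookup X u) → u ∈ X
T⇒∈ {X = X} {u} h = lookup⇒[]= u X (to T-≡ h)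

∉⇒¬T : ∀ {k} {X : Subset k} {u} → u ∉ X → ¬ T (lookup X u)
∉⇒¬T u∉X h = u∉X (T⇒∈ h)

¬T⇒∉ : ∀ {k} {X : Subset k} {u} → ¬ T (lookup X u) → u ∉ X
¬T⇒∉ ¬h u∈X = ¬h (∈⇒T u∈X)

survivors : ∀ {x y b} → ¬ T x → ¬ T y → T (x ∨ y ∨ b) → T b
survivors {false} {false} _  _  h = h
survivors {true}          ¬x _  _ = contradiction _ ¬x
survivors {false} {true}  _  ¬y _ = contradiction _ ¬y

∈-allSubsets : ∀ {k} (X : Subset k) → X ∈ᴸ allSubsets k
∈-allSubsets []          = hereᴸ refl
∈-allSubsets (true ∷ X)  = ∈-++⁺ˡ (∈-map⁺ (true ∷_) (∈-allSubsets X))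
∈-allSubsets (false ∷ X) = ∈-++⁺ʳ (map (true ∷_) (allSubsets _)) (∈-map⁺ (false ∷_) (∈-allSubsets X))

ReachAvoid-snoc : ∀ {G X u w v} → ReachAvoid G X u w → T (adj G w v) → v ∉ X → ReachAvoid G X u v
ReachAvoid-snoc (here w∉X)        w~v v∉X = step w∉X (to T-≡ w~v) (here v∉X)
ReachAvoid-snoc (step u∉X u~w′ r) w~v v∉X = step u∉X u~w′ (ReachAvoid-snoc r w~v v∉X)

module Reachability (G : Graph) (X : Subset (n G)) where

  grow : Coloring (n G) → Coloring (n G)
  grow c v = c v ∨ (not (lookup X v) ∧ any (λ w → c w ∧ adj G w v) (allFin (n G)))

  reachableB : Fin (n G) → Coloring (n G)
  reachableB u = iter (n G) grow (λ v → not (lookup X u) ∧ ⌊ u ≟ v ⌋)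

  reachableB-sound : ∀ u v → T (reachableB u v) → ReachAvoid G X u v
  reachableB-sound u = iter-preserves Sound start grown (n G)
    where
    Sound : Coloring (n G) → Set
    Sound c = ∀ v → T (c v) → ReachAvoid G X u v
    start : Sound (λ v → not (lookup X u) ∧ ⌊ u ≟ v ⌋)
    start v h with to (T-∧ {not (lookup X u)}) h
    ... | u∉X , u≡v rewrite toWitness u≡v = here (¬T⇒∉ (not-T u∉X))
    grown : ∀ c → Sound c → Sound (grow c)
    grown c sound v h with to (T-∨ {c v}) h
    ... | inj₁ cv = sound v cv
    ... | inj₂ new with to (T-∧ {not (lookup X v)}) new
    ...   | v∉X , found with anyFin⁻ _ found
    ...     | w , cw∧w~v = ReachAvoid-snoc (sound w (proj₁ (to T-∧ cw∧w~v))) (proj₂ (to T-∧ cw∧w~v))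
                                           (¬T⇒∉ (not-T v∉X))

  reachableB-start : ∀ u → u ∉ X → T (reachableB u u)
  reachableB-start u u∉X = iter-preserves (λ c → T (c u)) {grow} start (λ c cu → from T-∨ (inj₁ cu)) (n G)
    where
    start : T (not (lookup X u) ∧ ⌊ u ≟ u ⌋)
    start = from T-∧ (T-not (∉⇒¬T u∉X) , fromWitness refl)

  closedB : Coloring (n G) → Bool
  closedB C = all (λ u → all (λ w → not (C u ∧ not (lookup X u) ∧ adj G u w ∧ not (lookup X w)) ∨ C w)
                              (allFin (n G))) (allFin (n G))

  closedB-sound : ∀ C → T (closedB C) → ∀ {u v} → ReachAvoid G X u v → T (C u) → T (C v)
  closedB-sound C closed (here _) Cu = Cu
  closedB-sound C closed {u} (step {w = w} u∉X u~w r) Cu = closedB-sound C closed r Cw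
    where
    entry : T (not (C u ∧ not (lookup X u) ∧ adj G u w ∧ not (lookup X w)) ∨ C w)
    entry = allFin⁻ _ (allFin⁻ _ closed u) w
    leaves : T (C u ∧ not (lookup X u) ∧ adj G u w ∧ not (lookup X w))
    leaves = from T-∧ (Cu , from T-∧ (T-not (∉⇒¬T u∉X) ,
             from T-∧ (from T-≡ u~w , T-not (∉⇒¬T (startAvoids r)))))
      where
      startAvoids : ∀ {a b} → ReachAvoid G X a b → a ∉ X
      startAvoids (here a∉X)     = a∉X
      startAvoids (step a∉X _ _) = a∉X
    Cw : T (C w)
    Cw with to (T-∨ {not (C u ∧ not (lookup X u) ∧ adj G u w ∧ not (lookup X w))}) entry
    ... | inj₁ escapes = contradiction leaves (not-T escapes)
    ... | inj₂ Cw      = Cw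

  -- certificate that X disconnects G: surviving u and v and a closed region around u missing v
  separatedB : Fin (n G) → Fin (n G) → Bool
  separatedB u v = not (lookup X u) ∧ not (lookup X v) ∧ not (reachableB u v) ∧ closedB (reachableB u)

  disconnectsB : Bool
  disconnectsB = any (λ u → any (separatedB u) (allFin (n G))) (allFin (n G))

  disconnectsB-sound : T disconnectsB → Disconnects G X
  disconnectsB-sound h with anyFin⁻ _ h
  ... | u , h′ with anyFin⁻ _ h′
  ...   | v , sep with to (T-∧ {not (lookup X u)}) sep
  ...     | u∉X , sep′ with to (T-∧ {not (lookup X v)}) sep′
  ...       | v∉X , sep″ with to (T-∧ {not (reachableB u v)}) sep″
  ...         | missed , closed =
    u , v , ¬T⇒∉ (not-T u∉X) , ¬T⇒∉ (not-T v∉X) ,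
    λ r → not-T missed (closedB-sound (reachableB u) closed r (reachableB-start u (¬T⇒∉ (not-T u∉X))))

  trivialB : Bool
  trivialB = all (λ u → all (λ v → lookup X u ∨ lookup X v ∨ ⌊ u ≟ v ⌋) (allFin (n G))) (allFin (n G))

  separatingB : Bool
  separatingB = disconnectsB ∨ trivialB

  separatingB-sound : T separatingB → Separating G X
  separatingB-sound h with to (T-∨ {disconnectsB}) h
  ... | inj₁ disconnects = inj₁ (disconnectsB-sound disconnects)
  ... | inj₂ trivial     = inj₂ λ u v u∉X v∉X →
    toWitness (survivors (∉⇒¬T u∉X) (∉⇒¬T v∉X) (allFin⁻ _ (allFin⁻ _ trivial u) v))

  connectedB : Bool
  connectedB = all (λ u → all (λ v → lookup X u ∨ lookup X v ∨ reachableB u v) (allFin (n G))) (allFin (n G))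

  connectedB-sound : T connectedB → ∀ u v → u ∉ X → v ∉ X → ReachAvoid G X u v
  connectedB-sound h u v u∉X v∉X =
    reachableB-sound u v (survivors (∉⇒¬T u∉X) (∉⇒¬T v∉X) (allFin⁻ _ (allFin⁻ _ h u) v))

  -- G - X is connected and has two distinct vertices, so X does not separate G
  robustB : Bool
  robustB = connectedB ∧ any (λ u → any (λ v → not (lookup X u) ∧ not (lookup X v) ∧ not ⌊ u ≟ v ⌋)
                                          (allFin (n G))) (allFin (n G))

  robustB-sound : T robustB → ¬ Separating G X
  robustB-sound h with to (T-∧ {connectedB}) h
  ... | connected , twoVertices with anyFin⁻ _ twoVertices
  ...   | u , h′ with anyFin⁻ _ h′
  ...     | v , uv with to (T-∧ {not (lookup X u)}) uv
  ...       | u∉X , uv′ with to (T-∧ {not (lookup X v)}) uv′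
  ...         | v∉X , u≢v = λ
    { (inj₁ (a , b , a∉X , b∉X , unreachable)) → unreachable (connectedB-sound connected a b a∉X b∉X)
    ; (inj₂ trivial) → not-T u≢v (fromWitness (trivial u v (¬T⇒∉ (not-T u∉X)) (¬T⇒∉ (not-T v∉X))))
    }

emptySet-outside : ∀ {k} (u : Fin k) → u ∉ emptySet k
emptySet-outside u = ¬T⇒∉ (subst (λ b → ¬ T b) (≡-sym (lookup∘tabulate (λ _ → false) u)) (λ ()))

connected-by-check : ∀ G → T (Reachability.connectedB G (emptySet (n G))) → Connected G
connected-by-check G h u v = Reachability.connectedB-sound G _ h u v (emptySet-outside u) (emptySet-outside v)

disconnected-by-check : ∀ G → T (Reachability.disconnectsB G (emptySet (n G))) → ¬ Connected G
disconnected-by-check G h connected with Reachability.disconnectsB-sound G _ h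
... | u , v , _ , _ , unreachable = unreachable (connected u v)

noSmallSeparatorB : Graph → ℕ → Bool
noSmallSeparatorB G k = all (λ X → not (∣ X ∣ <ᵇ k) ∨ Reachability.robustB G X) (allSubsets (n G))

vertexConnectivity-by-check : ∀ G k (X : Subset (n G)) → ∣ X ∣ ≡ k →
  T (Reachability.separatingB G X) → T (noSmallSeparatorB G k) → VertexConnectivity G k
vertexConnectivity-by-check G k X size separating none =
  (X , size , Reachability.separatingB-sound G X separating) , noSmaller
  where
  noSmaller : ∀ Y → ∣ Y ∣ < k → ¬ Separating G Y
  noSmaller Y small with to (T-∨ {not (∣ Y ∣ <ᵇ k)}) (All-lookup (all⁺ _ _ none) (∈-allSubsets Y))
  ... | inj₁ large  = contradiction (<⇒<ᵇ small) (not-T large)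
  ... | inj₂ robust = Reachability.robustB-sound G Y robust

Matrix : ℕ → Set
Matrix k = Vec (Vec Bool k) k

symmetricB : ∀ {k} → Matrix k → Bool
symmetricB {k} A = all (λ u → all (λ v → ⌊ lookup (lookup A u) v Bool.≟ lookup (lookup A v) u ⌋) (allFin k)) (allFin k)

looplessB : ∀ {k} → Matrix k → Bool
looplessB {k} A = all (λ v → not (lookup (lookup A v) v)) (allFin k)

fromMatrix : ∀ k (A : Matrix k) → T (symmetricB A) → T (looplessB A) → Graph
fromMatrix k A symmetric loopless = record
  { n      = k
  ; adj    = λ u v → lookup (lookup A u) v
  ; sym    = λ u v → toWitness (allFin⁻ _ (allFin⁻ _ symmetric u) v)
  ; irrefl = λ v → to T-not-≡ (allFin⁻ _ loopless v)
  }

● ○ : Bool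
● = true
○ = false

-- Part (2): the spider obtained by joining the centres of two paths P₃ is connected,
-- while the disjoint union 2P₃ is not; both have the same power domination polynomial.
spider twoPaths : Graph
spider = fromMatrix 6
  ( (○ ∷ ● ∷ ○ ∷ ○ ∷ ● ∷ ● ∷ [])
  ∷ (● ∷ ○ ∷ ● ∷ ● ∷ ○ ∷ ○ ∷ [])
  ∷ (○ ∷ ● ∷ ○ ∷ ○ ∷ ○ ∷ ○ ∷ [])
  ∷ (○ ∷ ● ∷ ○ ∷ ○ ∷ ○ ∷ ○ ∷ [])
  ∷ (● ∷ ○ ∷ ○ ∷ ○ ∷ ○ ∷ ○ ∷ [])
  ∷ (● ∷ ○ ∷ ○ ∷ ○ ∷ ○ ∷ ○ ∷ [])
  ∷ []) _ _
twoPaths = fromMatrix 6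
  ( (○ ∷ ○ ∷ ○ ∷ ○ ∷ ● ∷ ● ∷ [])
  ∷ (○ ∷ ○ ∷ ● ∷ ● ∷ ○ ∷ ○ ∷ [])
  ∷ (○ ∷ ● ∷ ○ ∷ ○ ∷ ○ ∷ ○ ∷ [])
  ∷ (○ ∷ ● ∷ ○ ∷ ○ ∷ ○ ∷ ○ ∷ [])
  ∷ (● ∷ ○ ∷ ○ ∷ ○ ∷ ○ ∷ ○ ∷ [])
  ∷ (● ∷ ○ ∷ ○ ∷ ○ ∷ ○ ∷ ○ ∷ [])
  ∷ []) _ _

spider≈twoPaths : SamePDP spider twoPaths
spider≈twoPaths 1 _ = refl
spider≈twoPaths 2 _ = refl
spider≈twoPaths 3 _ = refl
spider≈twoPaths 4 _ = refl
spider≈twoPaths 5 _ = refl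
spider≈twoPaths 6 _ = refl
spider≈twoPaths (suc (suc (suc (suc (suc (suc (suc _))))))) _ = refl

part2 : Σ Graph λ G → Σ Graph λ H → Connected G × ¬ Connected H × SamePDP G H
part2 = spider , twoPaths , connected-by-check spider _ , disconnected-by-check twoPaths _ , spider≈twoPaths

path₄ cycle₄ complete₄ : Graph
path₄ = fromMatrix 4
  ( (○ ∷ ● ∷ ○ ∷ ○ ∷ [])
  ∷ (● ∷ ○ ∷ ● ∷ ○ ∷ [])
  ∷ (○ ∷ ● ∷ ○ ∷ ● ∷ [])
  ∷ (○ ∷ ○ ∷ ● ∷ ○ ∷ [])
  ∷ []) _ _
cycle₄ = fromMatrix 4
  ( (○ ∷ ● ∷ ○ ∷ ● ∷ [])
  ∷ (● ∷ ○ ∷ ● ∷ ○ ∷ [])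
  ∷ (○ ∷ ● ∷ ○ ∷ ● ∷ [])
  ∷ (● ∷ ○ ∷ ● ∷ ○ ∷ [])
  ∷ []) _ _
complete₄ = fromMatrix 4
  ( (○ ∷ ● ∷ ● ∷ ● ∷ [])
  ∷ (● ∷ ○ ∷ ● ∷ ● ∷ [])
  ∷ (● ∷ ● ∷ ○ ∷ ● ∷ [])
  ∷ (● ∷ ● ∷ ● ∷ ○ ∷ [])
  ∷ []) _ _

κ-path₄ : VertexConnectivity path₄ 1
κ-path₄ = vertexConnectivity-by-check path₄ 1 (false ∷ true ∷ false ∷ false ∷ []) refl _ _

κ-cycle₄ : VertexConnectivity cycle₄ 2
κ-cycle₄ = vertexConnectivity-by-check cycle₄ 2 (true ∷ false ∷ true ∷ false ∷ []) refl _ _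

κ-complete₄ : VertexConnectivity complete₄ 3
κ-complete₄ = vertexConnectivity-by-check complete₄ 3 (true ∷ true ∷ true ∷ false ∷ []) refl _ _

path₄≈cycle₄ : SamePDP path₄ cycle₄
path₄≈cycle₄ 1 _ = refl
path₄≈cycle₄ 2 _ = refl
path₄≈cycle₄ 3 _ = refl
path₄≈cycle₄ 4 _ = refl
path₄≈cycle₄ (suc (suc (suc (suc (suc _))))) _ = refl

cycle₄≈complete₄ : SamePDP cycle₄ complete₄
cycle₄≈complete₄ 1 _ = refl
cycle₄≈complete₄ 2 _ = refl
cycle₄≈complete₄ 3 _ = refl
cycle₄≈complete₄ 4 _ = refl
cycle₄≈complete₄ (suc (suc (suc (suc (suc _))))) _ = refl

part3 : Σ ℕ λ k → Σ Graph λ G₁ → Σ Graph λ G₂ → Σ Graph λ G₃ →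
  (n G₁ ≡ k) × (n G₂ ≡ k) × (n G₃ ≡ k) ×
  VertexConnectivity G₁ 1 × VertexConnectivity G₂ 2 × VertexConnectivity G₃ (k ∸ 1) ×
  SamePDP G₁ G₂ × SamePDP G₂ G₃
part3 = 4 , path₄ , cycle₄ , complete₄ , refl , refl , refl ,
        κ-path₄ , κ-cycle₄ , κ-complete₄ , path₄≈cycle₄ , cycle₄≈complete₄

proposition27 :
    ((m : ℕ) → 1 ≤ m →
      Σ (Fin m → Graph) λ Gs →
        (∀ i j → i ≢ j → ¬ Iso (Gs i) (Gs j)) ×
        (∀ i j → SamePDP (Gs i) (Gs j)))
    ×
    (Σ Graph λ G → Σ Graph λ H →
      Connected G × ¬ Connected H × SamePDP G H)
    ×
    (Σ ℕ λ k → Σ Graph λ G₁ → Σ Graph λ G₂ → Σ Graph λ G₃ →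
      (n G₁ ≡ k) × (n G₂ ≡ k) × (n G₃ ≡ k) ×
      VertexConnectivity G₁ 1 × VertexConnectivity G₂ 2 ×
      VertexConnectivity G₃ (k ∸ 1) ×
      SamePDP G₁ G₂ × SamePDP G₂ G₃)
proposition27 = part1 , part2 , part3
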